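{- Let $G$ be a digraph, let $u_1,u_2$ be distinct vertices of $G$ and $A_i=G-u_i$ for $i=1,2$. (a) Every da-hypomorph $H$ of $G$ is a completion of some dapasting of the dacards $(A_1,\mathrm{dt}_G(u_1))$ and $(A_2,\mathrm{dt}_G(u_2))$ as members of $\mathrm{Dadeck}(G)$. (b) Every hypomorph $H$ of $G$ is a completion of some pasting of the cards $A_1$ and $A_2$ as members of $\mathrm{Deck}(G)$.
   Context: Digraphs are finite, without loops or multiple arcs. For a vertex $x$ of a digraph $D$, $\mathrm{dt}_D(x)=(a,b,c)$ where $a,b,c$ count vertices $w$ such that respectively only $xw$, only $wx$, both $xw,wx$ are arcs. Cards are isomorphism classes of $D-x$; dacards are pairs $(D-x,\mathrm{dt}_D(x))$. $\mathrm{Deck}(D)$ ($\mathrm{Dadeck}(D)$) is the multiset of cards (dacards); digraphs with equal deck (dadeck) are hypomorphs (da-hypomorphs). A pasting of cards $A\cong G-v_1$, $B\cong G-v_2$ ($v_1\neq v_2$) as members of $\mathrm{Deck}(G)$ is a digraph $P$ with distinct non-adjacent vertices $u,v$ both labeled $e$, with $P-u\cong A$, $P-v\cong B$, such that some $H\in\{P,P+uv,P+vu,P+uv+vu\}$ ($P+xy$ = $P$ with arc $xy$ added) is hypomorphic to $G$; such $H$ and digraphs isomorphic to it are completions of $P$. A dapasting of dacards $(A,\alpha),(B,\beta)$ of $G$ (from distinct vertices) as members of $\mathrm{Dadeck}(G)$ is a digraph $P$ with distinct non-adjacent vertices $u,v$ labeled $(e,\alpha)$, $(e,\beta)$, $P-u\cong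 A$, $P-v\cong B$, such that some $Y\in\{P,P+uv,P+vu,P+uv+vu\}$ has $\mathrm{dt}_Y(u)=\alpha$, $\mathrm{dt}_Y(v)=\beta$ and is da-hypomorphic to $G$; such $Y$ and digraphs isomorphic to it are completions of $P$. -}

module Defs where

open import Data.Nat using (ℕ; zero; suc; _+_)
open import Data.Bool using (Bool; true; false; _∧_; _∨_; not; if_then_else_)
open import Data.Fin using (Fin; zero; suc; punchIn; _≟_)
open import Data.Product using (Σ; Σ-syntax; ∃; ∃-syntax; _×_; _,_)
open import Function.Bundles using (_↔_; Inverse)
open import Relation.Binary.PropositionalEquality using (_≡_; _≢_)
open import Relation.Nullary.Decidable using (⌊_⌋)

record Digraph (n : ℕ) : Set where
  constructor mkDigraph
  field
    adj : Fin n → Fin n → Bool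
open Digraph public

Loopless : ∀ {n} → Digraph n → Set
Loopless D = ∀ x → adj D x x ≡ false

_≅_ : ∀ {n} → Digraph n → Digraph n → Set
_≅_ {n} D E = Σ[ f ∈ Fin n ↔ Fin n ]
  (∀ i j → adj D i j ≡ adj E (Inverse.to f i) (Inverse.to f j))

_-_ : ∀ {n} → Digraph (suc n) → Fin (suc n) → Digraph n
(D - x) = mkDigraph (λ i j → adj D (punchIn x i) (punchIn x j))

countF : ∀ {n} → (Fin n → Bool) → ℕ
countF {zero} p = 0
countF {suc n} p = (if p zero then 1 else 0) + countF (λ w → p (suc w))

DegTriple : Set
DegTriple = ℕ × ℕ × ℕ

dt : ∀ {n} → Digraph n → Fin n → DegTriple
dt D x =
  countF (λ w → adj D x w ∧ not (adj D w x)) ,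
  countF (λ w → not (adj D x w) ∧ adj D w x) ,
  countF (λ w → adj D x w ∧ adj D w x)

-- Equality of decks (as multisets of isomorphism classes of cards):
-- a bijection of vertex sets matching cards up to isomorphism.
Hypomorphic : ∀ {n} → Digraph (suc n) → Digraph (suc n) → Set
Hypomorphic {n} D E = Σ[ σ ∈ Fin (suc n) ↔ Fin (suc n) ]
  (∀ v → (D - v) ≅ (E - Inverse.to σ v))

DaHypomorphic : ∀ {n} → Digraph (suc n) → Digraph (suc n) → Set
DaHypomorphic {n} D E = Σ[ σ ∈ Fin (suc n) ↔ Fin (suc n) ]
  (∀ v → ((D - v) ≅ (E - Inverse.to σ v)) × (dt D v ≡ dt E (Inverse.to σ v)))

-- The four digraphs P, P+uv, P+vu, P+uv+vu, indexed by two booleans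
-- (b₁: add arc uv, b₂: add arc vu).
complete : ∀ {n} → Digraph n → Fin n → Fin n → Bool → Bool → Digraph n
complete P u v b₁ b₂ = mkDigraph (λ x y →
  adj P x y ∨ ((b₁ ∧ ⌊ x ≟ u ⌋ ∧ ⌊ y ≟ v ⌋) ∨ (b₂ ∧ ⌊ x ≟ v ⌋ ∧ ⌊ y ≟ u ⌋)))

-- A pasting of cards A, B as members of Deck(G): the digraph P with its
-- two distinguished (labelled e) vertices u, v.
record Pasting {n} (G : Digraph (suc n)) (A B : Digraph n) : Set where
  field
    v₁ v₂ : Fin (suc n)
    v₁≢v₂ : v₁ ≢ v₂
    A≅ : A ≅ (G - v₁)
    B≅ : B ≅ (G - v₂)
    P : Digraph (suc n)
    P-loopless : Loopless P
    u v : Fin (suc n)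
    u≢v : u ≢ v
    nonadj-uv : adj P u v ≡ false
    nonadj-vu : adj P v u ≡ false
    P-u≅A : (P - u) ≅ A
    P-v≅B : (P - v) ≅ B
    has-completion : Σ[ b₁ ∈ Bool ] Σ[ b₂ ∈ Bool ] Hypomorphic (complete P u v b₁ b₂) G

IsCompletion : ∀ {n} {G : Digraph (suc n)} {A B : Digraph n} →
  Pasting G A B → Digraph (suc n) → Set
IsCompletion {G = G} π H = Σ[ b₁ ∈ Bool ] Σ[ b₂ ∈ Bool ]
  (Hypomorphic (complete P u v b₁ b₂) G × (complete P u v b₁ b₂ ≅ H))
  where open Pasting π

-- A dapasting of dacards (A, α), (B, β) as members of Dadeck(G):
-- P with distinguished vertices u, v labelled (e, α), (e, β).
record DaPasting {n} (G : Digraph (suc n)) (A : Digraph n) (α : DegTriple)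
                 (B : Digraph n) (β : DegTriple) : Set where
  field
    v₁ v₂ : Fin (suc n)
    v₁≢v₂ : v₁ ≢ v₂
    A≅ : A ≅ (G - v₁)
    α≡ : α ≡ dt G v₁
    B≅ : B ≅ (G - v₂)
    β≡ : β ≡ dt G v₂
    P : Digraph (suc n)
    P-loopless : Loopless P
    u v : Fin (suc n)
    u≢v : u ≢ v
    nonadj-uv : adj P u v ≡ false
    nonadj-vu : adj P v u ≡ false
    P-u≅A : (P - u) ≅ A
    P-v≅B : (P - v) ≅ B
    has-completion : Σ[ b₁ ∈ Bool ] Σ[ b₂ ∈ Bool ]
      ((dt (complete P u v b₁ b₂) u ≡ α) × (dt (complete P u v b₁ b₂) v ≡ β)
       × DaHypomorphic (complete P u v b₁ b₂) G)

IsDaCompletion : ∀ {n} {G : Digraph (suc n)} {A B : Digraph n} {α β : DegTriple} →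
  DaPasting G A α B β → Digraph (suc n) → Set
IsDaCompletion {G = G} {α = α} {β = β} π H = Σ[ b₁ ∈ Bool ] Σ[ b₂ ∈ Bool ]
  ((dt (complete P u v b₁ b₂) u ≡ α) × (dt (complete P u v b₁ b₂) v ≡ β)
   × DaHypomorphic (complete P u v b₁ b₂) G × (complete P u v b₁ b₂ ≅ H))
  where open DaPasting π

{-# OPTIONS --safe #-}
-- A (da-)hypomorphism σ from H to G matches the (da)card of H at wᵢ := σ⁻¹ uᵢ
-- with that of G at uᵢ, and w₁ ≠ w₂. Deleting the arcs between w₁ and w₂
-- leaves H - w₁ and H - w₂ unchanged, so the result is a (da)pasting of the
-- two (da)cards of G; adding back exactly the arcs H had between w₁ and w₂
-- completes it to H itself, which is (da-)hypomorphic to G.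
module Submission where

open import Defs
open import Data.Nat using (ℕ; suc; _+_)
open import Data.Fin using (Fin; punchIn; _≟_)
open import Data.Fin.Properties using (punchInᵢ≢i)
open import Data.Bool using (Bool; true; false; _∧_; _∨_; not; if_then_else_)
open import Data.Bool.Properties using (∧-zeroʳ; ∧-identityʳ; ∨-zeroʳ; ∨-comm)
open import Data.Product using (Σ; _×_; _,_; proj₁; proj₂)
open import Function.Bundles using (_↔_; Inverse)
open import Function.Construct.Identity using (↔-id)
open import Relation.Binary.PropositionalEquality
open import Relation.Nullary using (yes; no)
open import Relation.Nullary.Decidable using (⌊_⌋; isYes≗does; dec-true; dec-false)

open Inverse using (to; from)

infix 4 _≐_

_≐_ : ∀ {n} → Digraph n → Digraph n → Set
D ≐ E = ∀ x y → adj D x y ≡ adj E x y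

≐-sym : ∀ {n} {D E : Digraph n} → D ≐ E → E ≐ D
≐-sym D≐E x y = sym (D≐E x y)

≐-trans : ∀ {n} {D E F : Digraph n} → D ≐ E → E ≐ F → D ≐ F
≐-trans D≐E E≐F x y = trans (D≐E x y) (E≐F x y)

≐⇒≅ : ∀ {n} {D E : Digraph n} → D ≐ E → D ≅ E
≐⇒≅ {n} D≐E = ↔-id (Fin n) , D≐E

≅-respˡ-≐ : ∀ {n} {D D′ E : Digraph n} → D ≐ D′ → D ≅ E → D′ ≅ E
≅-respˡ-≐ D≐D′ (f , D≅E) = f , λ i j → trans (sym (D≐D′ i j)) (D≅E i j)

-‿cong : ∀ {n} {D E : Digraph (suc n)} (v : Fin (suc n)) → D ≐ E → (D - v) ≐ (E - v)
-‿cong v D≐E i j = D≐E (punchIn v i) (punchIn v j)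

countF-cong : ∀ {n} {p q : Fin n → Bool} → (∀ w → p w ≡ q w) → countF p ≡ countF q
countF-cong {ℕ.zero} p≗q = refl
countF-cong {suc n} p≗q =
  cong₂ _+_ (cong (λ b → if b then 1 else 0) (p≗q Fin.zero))
            (countF-cong (λ w → p≗q (Fin.suc w)))

dt-cong : ∀ {n} {D E : Digraph n} → D ≐ E → ∀ x → dt D x ≡ dt E x
dt-cong D≐E x =
  cong₂ _,_ (countF-cong λ w → cong₂ (λ a b → a ∧ not b) (D≐E x w) (D≐E w x))
 (cong₂ _,_ (countF-cong λ w → cong₂ (λ a b → not a ∧ b) (D≐E x w) (D≐E w x))
            (countF-cong λ w → cong₂ _∧_ (D≐E x w) (D≐E w x)))

hypomorphic-respˡ-≐ : ∀ {n} {D D′ G : Digraph (suc n)} →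
  D ≐ D′ → Hypomorphic D G → Hypomorphic D′ G
hypomorphic-respˡ-≐ {G = G} D≐D′ (σ , cards) =
  σ , λ v → ≅-respˡ-≐ {E = G - to σ v} (-‿cong v D≐D′) (cards v)

daHypomorphic-respˡ-≐ : ∀ {n} {D D′ G : Digraph (suc n)} →
  D ≐ D′ → DaHypomorphic D G → DaHypomorphic D′ G
daHypomorphic-respˡ-≐ {G = G} D≐D′ (σ , dacards) = σ , λ v →
  ≅-respˡ-≐ {E = G - to σ v} (-‿cong v D≐D′) (proj₁ (dacards v)) ,
  trans (sym (dt-cong D≐D′ v)) (proj₂ (dacards v))

⌊≟⌋-refl : ∀ {n} (x : Fin n) → ⌊ x ≟ x ⌋ ≡ true
⌊≟⌋-refl x = trans (isYes≗does (x ≟ x)) (dec-true (x ≟ x) refl)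

⌊≟⌋-≢ : ∀ {n} {p x : Fin n} → p ≢ x → ⌊ p ≟ x ⌋ ≡ false
⌊≟⌋-≢ {p = p} {x} p≢x = trans (isYes≗does (p ≟ x)) (dec-false (p ≟ x) p≢x)

-- Same shape as the guards in `complete`, so that `unmask` applies verbatim.
joins : ∀ {n} → Fin n → Fin n → Fin n → Fin n → Bool
joins x y p q = (⌊ p ≟ x ⌋ ∧ ⌊ q ≟ y ⌋) ∨ (⌊ p ≟ y ⌋ ∧ ⌊ q ≟ x ⌋)

joins-sym : ∀ {n} (x y p q : Fin n) → joins x y p q ≡ joins y x p q
joins-sym x y p q = ∨-comm (⌊ p ≟ x ⌋ ∧ ⌊ q ≟ y ⌋) _

joins-avoid : ∀ {n} (x y : Fin n) {p q : Fin n} → p ≢ x → q ≢ x → joins x y p q ≡ false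
joins-avoid x y {p} {q} p≢x q≢x
  rewrite ⌊≟⌋-≢ p≢x | ⌊≟⌋-≢ q≢x = ∧-zeroʳ ⌊ p ≟ y ⌋

≟∧≟⇒adj≡ : ∀ {n} (H : Digraph n) (x y p q : Fin n) →
  ⌊ p ≟ x ⌋ ∧ ⌊ q ≟ y ⌋ ≡ true → adj H x y ≡ adj H p q
≟∧≟⇒adj≡ H x y p q with p ≟ x | q ≟ y
... | yes refl | yes refl = λ _ → refl
... | yes _    | no _     = λ ()
... | no _     | _        = λ ()

removeArcs : ∀ {n} → Digraph n → Fin n → Fin n → Digraph n
removeArcs H x y = mkDigraph λ p q → adj H p q ∧ not (joins x y p q)

removeArcs-sym : ∀ {n} (H : Digraph n) x y → removeArcs H x y ≐ removeArcs H y x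
removeArcs-sym H x y p q = cong (λ b → adj H p q ∧ not b) (joins-sym x y p q)

removeArcs-loopless : ∀ {n} (H : Digraph n) x y → Loopless H → Loopless (removeArcs H x y)
removeArcs-loopless H x y loopless p rewrite loopless p = refl

removeArcs-nonadj : ∀ {n} (H : Digraph n) x y {p q} →
  joins x y p q ≡ true → adj (removeArcs H x y) p q ≡ false
removeArcs-nonadj H x y {p} {q} pq-joins rewrite pq-joins = ∧-zeroʳ (adj H p q)

removeArcs-nonadj-xy : ∀ {n} (H : Digraph n) x y → adj (removeArcs H x y) x y ≡ false
removeArcs-nonadj-xy H x y = removeArcs-nonadj H x y
  (cong (_∨ (⌊ x ≟ y ⌋ ∧ ⌊ y ≟ x ⌋)) (cong₂ _∧_ (⌊≟⌋-refl x) (⌊≟⌋-refl y)))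

removeArcs-nonadj-yx : ∀ {n} (H : Digraph n) x y → adj (removeArcs H x y) y x ≡ false
removeArcs-nonadj-yx H x y =
  trans (removeArcs-sym H x y y x) (removeArcs-nonadj-xy H y x)

removeArcs-cardˡ : ∀ {n} (H : Digraph (suc n)) x y → (removeArcs H x y - x) ≐ (H - x)
removeArcs-cardˡ H x y i j
  rewrite joins-avoid x y (punchInᵢ≢i x i) (punchInᵢ≢i x j) = ∧-identityʳ _

removeArcs-cardʳ : ∀ {n} (H : Digraph (suc n)) x y → (removeArcs H x y - y) ≐ (H - y)
removeArcs-cardʳ H x y =
  ≐-trans (-‿cong y (removeArcs-sym H x y)) (removeArcs-cardˡ H y x)

unmask : ∀ a b c d e → (c ≡ true → b ≡ a) → (d ≡ true → e ≡ a) →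
  (a ∧ not (c ∨ d)) ∨ ((b ∧ c) ∨ (e ∧ d)) ≡ a
unmask true  b true  d     e b≡a _   rewrite b≡a refl = refl
unmask false b true  true  e b≡a e≡a rewrite b≡a refl | e≡a refl = refl
unmask false b true  false e b≡a _   rewrite b≡a refl | ∧-zeroʳ e = refl
unmask true  b false true  e _   e≡a rewrite e≡a refl = ∨-zeroʳ (b ∧ false)
unmask false b false true  e _   e≡a rewrite e≡a refl | ∧-zeroʳ b = refl
unmask true  b false false e _   _   = refl
unmask false b false false e _   _   rewrite ∧-zeroʳ b | ∧-zeroʳ e = refl

complete-removeArcs : ∀ {n} (H : Digraph n) x y →
  complete (removeArcs H x y) x y (adj H x y) (adj H y x) ≐ H
complete-removeArcs H x y p q =
  unmask (adj H p q) (adj H x y) (⌊ p ≟ x ⌋ ∧ ⌊ q ≟ y ⌋) (⌊ p ≟ y ⌋ ∧ ⌊ q ≟ x ⌋) (adj H y x)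
          (≟∧≟⇒adj≡ H x y p q) (≟∧≟⇒adj≡ H y x p q)

from-injective : ∀ {n} (σ : Fin n ↔ Fin n) {u₁ u₂ : Fin n} → u₁ ≢ u₂ → from σ u₁ ≢ from σ u₂
from-injective σ {u₁} {u₂} u₁≢u₂ eq = u₁≢u₂ (begin
  u₁              ≡⟨ Inverse.strictlyInverseˡ σ u₁ ⟨
  to σ (from σ u₁) ≡⟨ cong (to σ) eq ⟩
  to σ (from σ u₂) ≡⟨ Inverse.strictlyInverseˡ σ u₂ ⟩
  u₂              ∎)
  where open ≡-Reasoning

module Unpasting {n} {G H : Digraph (suc n)} (H-loopless : Loopless H)
  (σ : Fin (suc n) ↔ Fin (suc n)) (cards : ∀ v → (H - v) ≅ (G - to σ v))
  {u₁ u₂ : Fin (suc n)} (u₁≢u₂ : u₁ ≢ u₂) where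

  w₁ w₂ : Fin (suc n)
  w₁ = from σ u₁
  w₂ = from σ u₂

  P : Digraph (suc n)
  P = removeArcs H w₁ w₂

  C : Digraph (suc n)
  C = complete P w₁ w₂ (adj H w₁ w₂) (adj H w₂ w₁)

  C≐H : C ≐ H
  C≐H = complete-removeArcs H w₁ w₂

  card-from : ∀ u → (H - from σ u) ≅ (G - u)
  card-from u = subst (λ z → (H - from σ u) ≅ (G - z))
                      (Inverse.strictlyInverseˡ σ u) (cards (from σ u))

  P-w₁≅ : (P - w₁) ≅ (G - u₁)
  P-w₁≅ = ≅-respˡ-≐ {E = G - u₁} (≐-sym (removeArcs-cardˡ H w₁ w₂)) (card-from u₁)

  P-w₂≅ : (P - w₂) ≅ (G - u₂)
  P-w₂≅ = ≅-respˡ-≐ {E = G - u₂} (≐-sym (removeArcs-cardʳ H w₁ w₂)) (card-from u₂)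

  pasting : Hypomorphic C G → Pasting G (G - u₁) (G - u₂)
  pasting C~G = record
    { v₁ = u₁ ; v₂ = u₂ ; v₁≢v₂ = u₁≢u₂
    ; A≅ = ≐⇒≅ (λ _ _ → refl) ; B≅ = ≐⇒≅ (λ _ _ → refl)
    ; P = P ; P-loopless = removeArcs-loopless H w₁ w₂ H-loopless
    ; u = w₁ ; v = w₂ ; u≢v = from-injective σ u₁≢u₂
    ; nonadj-uv = removeArcs-nonadj-xy H w₁ w₂
    ; nonadj-vu = removeArcs-nonadj-yx H w₁ w₂
    ; P-u≅A = P-w₁≅ ; P-v≅B = P-w₂≅
    ; has-completion = adj H w₁ w₂ , adj H w₂ w₁ , C~G }

  dapasting : dt C w₁ ≡ dt G u₁ → dt C w₂ ≡ dt G u₂ → DaHypomorphic C G →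
    DaPasting G (G - u₁) (dt G u₁) (G - u₂) (dt G u₂)
  dapasting dt-w₁ dt-w₂ C~G = record
    { v₁ = u₁ ; v₂ = u₂ ; v₁≢v₂ = u₁≢u₂
    ; A≅ = ≐⇒≅ (λ _ _ → refl) ; α≡ = refl
    ; B≅ = ≐⇒≅ (λ _ _ → refl) ; β≡ = refl
    ; P = P ; P-loopless = removeArcs-loopless H w₁ w₂ H-loopless
    ; u = w₁ ; v = w₂ ; u≢v = from-injective σ u₁≢u₂
    ; nonadj-uv = removeArcs-nonadj-xy H w₁ w₂
    ; nonadj-vu = removeArcs-nonadj-yx H w₁ w₂
    ; P-u≅A = P-w₁≅ ; P-v≅B = P-w₂≅
    ; has-completion = adj H w₁ w₂ , adj H w₂ w₁ , dt-w₁ , dt-w₂ , C~G }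

hypomorph-completes-pasting : ∀ {n} {G H : Digraph (suc n)} {u₁ u₂ : Fin (suc n)} →
  u₁ ≢ u₂ → Loopless H → Hypomorphic H G →
  Σ (Pasting G (G - u₁) (G - u₂)) (λ π → IsCompletion π H)
hypomorph-completes-pasting {G = G} {H} u₁≢u₂ H-loopless H~G@(σ , cards) =
  pasting C~G , adj H w₁ w₂ , adj H w₂ w₁ , C~G , ≐⇒≅ C≐H
  where
  open Unpasting {G = G} {H} H-loopless σ cards u₁≢u₂
  C~G : Hypomorphic C G
  C~G = hypomorphic-respˡ-≐ {G = G} (≐-sym C≐H) H~G

daHypomorph-completes-dapasting : ∀ {n} {G H : Digraph (suc n)} {u₁ u₂ : Fin (suc n)} →
  u₁ ≢ u₂ → Loopless H → DaHypomorphic H G →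
  Σ (DaPasting G (G - u₁) (dt G u₁) (G - u₂) (dt G u₂)) (λ π → IsDaCompletion π H)
daHypomorph-completes-dapasting {G = G} {H} {u₁} {u₂} u₁≢u₂ H-loopless H~G@(σ , dacards) =
  dapasting (dt-from u₁) (dt-from u₂) C~G ,
  adj H w₁ w₂ , adj H w₂ w₁ , dt-from u₁ , dt-from u₂ , C~G , ≐⇒≅ C≐H
  where
  open Unpasting {G = G} {H} H-loopless σ (λ v → proj₁ (dacards v)) u₁≢u₂
  C~G : DaHypomorphic C G
  C~G = daHypomorphic-respˡ-≐ {G = G} (≐-sym C≐H) H~G
  dt-from : ∀ u → dt C (from σ u) ≡ dt G u
  dt-from u = trans (dt-cong C≐H (from σ u))
    (trans (proj₂ (dacards (from σ u))) (cong (dt G) (Inverse.strictlyInverseˡ σ u)))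

lemma4p7 : (n : ℕ) (G : Digraph (suc n)) → Loopless G →
    (u₁ u₂ : Fin (suc n)) → u₁ ≢ u₂ →
    ((H : Digraph (suc n)) → Loopless H → DaHypomorphic H G →
      Σ (DaPasting G (G - u₁) (dt G u₁) (G - u₂) (dt G u₂)) (λ π → IsDaCompletion π H))
    ×
    ((H : Digraph (suc n)) → Loopless H → Hypomorphic H G →
      Σ (Pasting G (G - u₁) (G - u₂)) (λ π → IsCompletion π H))
lemma4p7 n G _ u₁ u₂ u₁≢u₂ =
  (λ H → daHypomorph-completes-dapasting {G = G} {H} u₁≢u₂) ,
  (λ H → hypomorph-completes-pasting {G = G} {H} u₁≢u₂)
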